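{- Let $\Gamma$ be a basis, $M$ a $CL$-term and $\sigma$ a simple type. If $\Gamma \vdash_{CL} M : \sigma$ in the type assignment system $CL_\rightarrow$, then $\Gamma \vdash M : \sigma$ in $LCL$, where $\Gamma$ is regarded as a set of $LCL$-formulas (its declarations).
   Context: $CL$-terms are generated by $M,N ::= x \mid \mathsf{S} \mid \mathsf{K} \mid \mathsf{I} \mid MN$, where $x$ ranges over a countable set $V$ of term variables, $\mathsf S,\mathsf K,\mathsf I$ are constants and $MN$ is application (left-associative). $FV(M)$ is the set of variables occurring in $M$. The equational theory $\mathcal{EQ}^\eta$ derives equations $M=N$ between $CL$-terms from the axioms $M=M$, $\mathsf S MNL=(ML)(NL)$, $\mathsf K MN=M$, $\mathsf I M=M$ and the rules: from $M=N$ infer $N=M$; from $M=N$ and $N=L$ infer $M=L$; from $M=N$ infer $MP=NP$; from $M=N$ infer $PM=PN$; from $Mx=Nx$ with $x\notin FV(M)\cup FV(N)$ infer $M=N$. Write $M=_{w,\eta}N$ when $M=N$ is provable in $\mathcal{EQ}^\eta$ (extensional weak equality). Simple types: $\sigma,\tau ::= a \mid \sigma\to\tau$ with $a$ from a countable set of type variables. A statement is $M:\sigma$; a declaration is a statement $x:\sigma$ with $x$ a variable; a basis is a set of declarations with pairwise distinct variables. The system $CL_\rightarrow$ derives judgments $\Gamma\vdash_{CL} M:\sigma$ by: $\Gamma\vdash_{CL}x:\sigma$ whenever $x:\sigma\in\Gamma$; $\Gamma\vdash_{CL}\mathsf S:(\sigma\to(\rho\to\tau))\to((\sigma\to\rho)\to(\sigma\to\tau))$;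 $\Gamma\vdash_{CL}\mathsf K:\sigma\to(\tau\to\sigma)$; $\Gamma\vdash_{CL}\mathsf I:\sigma\to\sigma$ (for all types); from $\Gamma\vdash_{CL}M:\sigma\to\tau$ and $\Gamma\vdash_{CL}N:\sigma$ infer $\Gamma\vdash_{CL}MN:\tau$. $CL_\rightarrow$ also denotes the set of statements $M:\sigma$ with $\Gamma\vdash_{CL}M:\sigma$ for some basis $\Gamma$. The logic $LCL$: formulas are $\alpha,\beta ::= M:\sigma \mid \neg\alpha \mid \alpha\Rightarrow\beta$ where $M:\sigma\in CL_\rightarrow$; $\wedge,\vee,\Leftrightarrow$ are defined classically and $\bot$ abbreviates $\alpha\wedge\neg\alpha$. Axiom schemes: (Ax1) $\mathsf S:(\sigma\to(\tau\to\rho))\to((\sigma\to\tau)\to(\sigma\to\rho))$; (Ax2) $\mathsf K:\sigma\to(\tau\to\sigma)$; (Ax3) $\mathsf I:\sigma\to\sigma$; (Ax4) $(M:\sigma\to\tau)\Rightarrow((N:\sigma)\Rightarrow(MN:\tau))$ whenever $M:\sigma\to\tau,\ N:\sigma,\ MN:\tau\in CL_\rightarrow$; (Ax5) $M:\sigma\Rightarrow N:\sigma$ whenever $M=_{w,\eta}N$ and $M:\sigma,N:\sigma\in CL_\rightarrow$; (Ax6) $\alpha\Rightarrow(\beta\Rightarrow\alpha)$; (Ax7) $(\alpha\Rightarrow(\beta\Rightarrow\gamma))\Rightarrow((\alpha\Rightarrow\beta)\Rightarrow(\alpha\Rightarrow\gamma))$; (Ax8) $(\neg\alpha\Rightarrow\neg\beta)\Rightarrow((\neg\alpha\Rightarrow\beta)\Rightarrow\alpha)$.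 The only rule is Modus Ponens (from $\alpha\Rightarrow\beta$ and $\alpha$ infer $\beta$). For a set $T$ of formulas, $T\vdash\alpha$ means there is a finite sequence of formulas ending in $\alpha$ each of which is an axiom instance, a member of $T$, or obtained by Modus Ponens from earlier members. -}

module Defs where

open import Data.Nat using (ℕ)
open import Data.Product using (Σ; _×_; _,_)
open import Relation.Binary.PropositionalEquality using (_≡_)
open import Relation.Nullary using (¬_)
open import Data.Empty using (⊥)

Var : Set
Var = ℕ

TVar : Set
TVar = ℕ

infixl 9 _·_
data Term : Set where
  var : Var → Term
  S K I : Term
  _·_ : Term → Term → Term

data _occursIn_ (x : Var) : Term → Set where
  here : x occursIn var x
  left : ∀ {M N} → x occursIn M → x occursIn (M · N)
  right : ∀ {M N} → x occursIn N → x occursIn (M · N)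

infix 4 _=wη_
data _=wη_ : Term → Term → Set where
  eq-refl : ∀ {M} → M =wη M
  eq-S : ∀ {M N L} → S · M · N · L =wη (M · L) · (N · L)
  eq-K : ∀ {M N} → K · M · N =wη M
  eq-I : ∀ {M} → I · M =wη M
  eq-sym : ∀ {M N} → M =wη N → N =wη M
  eq-trans : ∀ {M N L} → M =wη N → N =wη L → M =wη L
  eq-appL : ∀ {M N P} → M =wη N → M · P =wη N · P
  eq-appR : ∀ {M N P} → M =wη N → P · M =wη P · N
  eq-ext : ∀ {M N x} → ¬ (x occursIn M) → ¬ (x occursIn N) →
           M · var x =wη N · var x → M =wη N

infixr 7 _⟶_
data Type : Set where
  tvar : TVar → Type
  _⟶_ : Type → Type → Type

record Basis : Set₁ where
  field
    decl : Var → Type → Set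
    distinct : ∀ {x σ τ} → decl x σ → decl x τ → σ ≡ τ
open Basis public

infix 3 _⊢CL_∶_
data _⊢CL_∶_ (Γ : Basis) : Term → Type → Set where
  ax-var : ∀ {x σ} → decl Γ x σ → Γ ⊢CL var x ∶ σ
  ax-S : ∀ {σ ρ τ} → Γ ⊢CL S ∶ (σ ⟶ (ρ ⟶ τ)) ⟶ ((σ ⟶ ρ) ⟶ (σ ⟶ τ))
  ax-K : ∀ {σ τ} → Γ ⊢CL K ∶ σ ⟶ (τ ⟶ σ)
  ax-I : ∀ {σ} → Γ ⊢CL I ∶ σ ⟶ σ
  →E : ∀ {M N σ τ} → Γ ⊢CL M ∶ σ ⟶ τ → Γ ⊢CL N ∶ σ → Γ ⊢CL M · N ∶ τ

InCL : Term → Type → Set₁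
InCL M σ = Σ Basis (λ Γ → Γ ⊢CL M ∶ σ)

infixr 5 _⇒_
infix 6 _∶_
infix 8 ¬f_
data Formula : Set where
  _∶_ : Term → Type → Formula
  ¬f_ : Formula → Formula
  _⇒_ : Formula → Formula → Formula

data WF : Formula → Set₁ where
  wf-atom : ∀ {M σ} → InCL M σ → WF (M ∶ σ)
  wf-neg : ∀ {α} → WF α → WF (¬f α)
  wf-imp : ∀ {α β} → WF α → WF β → WF (α ⇒ β)

FormulaSet : Set₁
FormulaSet = Formula → Set

-- T ⊢ α in LCL (Hilbert-style; inductive derivation trees are equivalent
-- to finite derivation sequences)
infix 3 _⊢LCL_
data _⊢LCL_ (T : FormulaSet) : Formula → Set₁ where
  Ax1 : ∀ {σ τ ρ} → T ⊢LCL S ∶ (σ ⟶ (τ ⟶ ρ)) ⟶ ((σ ⟶ τ) ⟶ (σ ⟶ ρ))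
  Ax2 : ∀ {σ τ} → T ⊢LCL K ∶ σ ⟶ (τ ⟶ σ)
  Ax3 : ∀ {σ} → T ⊢LCL I ∶ σ ⟶ σ
  Ax4 : ∀ {M N σ τ} → InCL M (σ ⟶ τ) → InCL N σ → InCL (M · N) τ →
        T ⊢LCL (M ∶ σ ⟶ τ) ⇒ ((N ∶ σ) ⇒ (M · N ∶ τ))
  Ax5 : ∀ {M N σ} → M =wη N → InCL M σ → InCL N σ →
        T ⊢LCL (M ∶ σ) ⇒ (N ∶ σ)
  Ax6 : ∀ {α β} → WF α → WF β → T ⊢LCL α ⇒ (β ⇒ α)
  Ax7 : ∀ {α β γ} → WF α → WF β → WF γ →
        T ⊢LCL (α ⇒ (β ⇒ γ)) ⇒ ((α ⇒ β) ⇒ (α ⇒ γ))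
  Ax8 : ∀ {α β} → WF α → WF β →
        T ⊢LCL (¬f α ⇒ ¬f β) ⇒ ((¬f α ⇒ β) ⇒ α)
  hyp : ∀ {α} → T α → T ⊢LCL α
  MP : ∀ {α β} → T ⊢LCL α ⇒ β → T ⊢LCL α → T ⊢LCL β

asFormulas : Basis → FormulaSet
asFormulas Γ (var x ∶ σ) = decl Γ x σ
asFormulas Γ _ = ⊥

module Submission where

open import Defs
open import Data.Product using (_,_)

-- Induction on the CL→ derivation; for →E the side conditions of Ax4 hold
-- because Γ itself witnesses the three statements as members of CL→.

⊢CL⇒⊢LCL : ∀ {Γ : Basis} {T : FormulaSet} →
           (∀ {x σ} → decl Γ x σ → T (var x ∶ σ)) →
           ∀ {M σ} → Γ ⊢CL M ∶ σ → T ⊢LCL M ∶ σ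
⊢CL⇒⊢LCL Γ⊆T (ax-var x∶σ) = hyp (Γ⊆T x∶σ)
⊢CL⇒⊢LCL Γ⊆T ax-S         = Ax1
⊢CL⇒⊢LCL Γ⊆T ax-K         = Ax2
⊢CL⇒⊢LCL Γ⊆T ax-I         = Ax3
⊢CL⇒⊢LCL {Γ} Γ⊆T (→E M∶σ⟶τ N∶σ) =
  MP (MP (Ax4 (Γ , M∶σ⟶τ) (Γ , N∶σ) (Γ , →E M∶σ⟶τ N∶σ))
         (⊢CL⇒⊢LCL Γ⊆T M∶σ⟶τ))
     (⊢CL⇒⊢LCL Γ⊆T N∶σ)

mainTheorem1 : (Γ : Basis) (M : Term) (σ : Type) →
    Γ ⊢CL M ∶ σ → asFormulas Γ ⊢LCL M ∶ σ
mainTheorem1 Γ M σ = ⊢CL⇒⊢LCL (λ x∶σ → x∶σ)
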